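{- Let $G$ be a profinite group acting with finite-tree fundamental domain on a proarbre $\mathcal{P}=(\Gamma_i,\theta_{ji})_{i\in I}$, with respect to the arborescent section $s$ of $\mathcal{P}$, a section $r$ of $(G_i,\varphi_{ji})_{i\in I}$ and finite trees $T_i\subset\Gamma_i$. Then $\varinjlim_r G_i$ acts on $\varinjlim_s\Gamma_i$ (by the induced action) with fundamental domain the finite tree $T:=\overline{T_i}$ (the image of $T_i$ in $\varinjlim_s\Gamma_i$, independent of $i$).
   Context: Graphs are oriented graphs (vertices $\mathcal{S}$, oriented edges $\mathcal{A}$, origin/terminus maps $o,t$); morphisms are maps on $\mathcal{S}\cup\mathcal{A}$ compatible with $o,t$; group actions on graphs are left actions by automorphisms without inversion. A fundamental domain for an action of a group on a graph $\Gamma$ is a subgraph $T$ such that $T\to(\text{group})\backslash\Gamma$ is a graph isomorphism. Prograph: projective system $(\Gamma_i,\theta_{ji})_{i\in I}$ of graphs over a right-directed preordered set with surjective morphisms. Graphically coherent section: family $s=(s_{ij})_{i\le j}$ of set maps $s_{ij}:\Gamma_i\to\Gamma_j$ (vertices to vertices, edges to edges), $\theta_{ji}\circ s_{ij}=\mathrm{id}$, $s_{ii}=\mathrm{id}$, $s_{jk}s_{ij}=s_{ik}$, with (C1): for all $i$ and edges $a$ of $\Gamma_i$ there is $i_0\ge i$ with $o(s_{ik}(a))=s_{i_0k}(o(s_{ii_0}(a)))$, $t(s_{ik}(a))=s_{i_0k}(t(s_{ii_0}(a)))$ for all $k\ge i_0$. $\varinjlim_s\Gamma_i$ is the graph with vertices/edges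 the set-theoretic inductive limits along the $s_{ij}$ and $o(\overline a)=\overline{o(s_{ii_0}(a))}$, $t(\overline a)=\overline{t(s_{ii_0}(a))}$. $s$ is arborescent if this graph is a tree; a proarbre is a prograph together with an arborescent section. For a projective system of finite groups $(G_i,\varphi_{ji})$ with surjective $\varphi_{ji}$, a family $r=(r_{ij})_{i\le j}$ of set maps with $\varphi_{ji}r_{ij}=\mathrm{id}$, $r_{ii}=\mathrm{id}$, $r_{jk}r_{ij}=r_{ik}$ gives a canonical injection $\varinjlim_r G_i\hookrightarrow\varprojlim_\varphi G_i$, $\overline{g_i}\mapsto(\varphi_{kj}(r_{ik}(g_i)))_j$ ($k\ge i,j$); $r$ is a section if its image is a subgroup (which gives $\varinjlim_r G_i$ a group structure). A profinite group $G$ acts on a prograph $\mathcal{P}$ if there is a filter base $(U_i)_{i\in I}$ of open normal subgroups with $U_j\subset U_i\iff i\le j$ and $\bigcap U_i=\{e\}$, each $G_i=G/U_i$ acts on $\Gamma_i$, and $\theta_{ji}(g\cdot x)=\varphi_{ji}(g)\cdot\theta_{ji}(x)$ for $i\le j$, $g\in G_j$, $x\in\Gamma_j$, where $\varphi_{ji}:G_j\to G_i$ is canonical. The action is completely compatible with $s$ and a section $r$ of $(G_i,\varphi_{ji})$ if (C3): for all $i$, $(g_i,a_i)\in G_i\times\Gamma_i$ there is $i_0\ge i$ with $s_{i_0k}(r_{ii_0}(g_i)\cdot s_{ii_0}(a_i))=r_{ik}(g_i)\cdot s_{ik}(a_i)$ for all $k\ge i_0$. In that case $\overline{g_i}\cdot\overline{a_i}:=\overline{r_{ii_0}(g_i)\cdot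 s_{ii_0}(a_i)}$ ($i_0$ as in (C3)) is a well-defined action of $\varinjlim_r G_i$ on $\varinjlim_s\Gamma_i$ (the induced action). $G$ acts with finite-tree fundamental domain (dfaf) on $\mathcal{P}$ if the action is completely compatible with $s$ and $r$, and for every $i$, $G_i$ acts on $\Gamma_i$ with fundamental domain a finite tree $T_i$, $s_{ij}(T_i)=T_j$ and $s_{ij}|_{T_i}$ is a graph morphism for $i\le j$, and (C4): for all $i$, $\alpha_i\in T_i$, $g_i\in G_i$ there is $i_0\ge i$ with $s_{ik}(g_i\cdot\alpha_i)=r_{ik}(g_i)\cdot s_{ik}(\alpha_i)$ for all $k\ge i_0$. -}

module Defs where

open import Level using (0ℓ)
open import Data.Product using (Σ; _×_; _,_; proj₁; proj₂)
open import Data.Sum using (_⊎_)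
open import Data.Unit using (⊤)
open import Data.Nat using (ℕ; suc; _%_)
open import Data.Nat.DivMod using (m%n<n)
open import Data.Fin using (Fin; toℕ; fromℕ<)
open import Data.List using (List)
open import Data.List.Relation.Unary.Any using (Any)
open import Relation.Binary.PropositionalEquality using (_≡_)
open import Relation.Nullary using (¬_)
open import Algebra.Bundles using (Group)

-- Oriented graphs (vertices S, edges A, origin / terminus o, t)

record Graph : Set₁ where
  field
    S A : Set
    o t : A → S

-- Oriented graphs whose vertex/edge sets carry an equality relation
-- (needed for inductive limits, which are quotients: Agda has no
-- quotient types, so the limit is presented as a setoid-like graph).
record SGraph : Set₁ where
  field
    S A : Set
    _≈S_ : S → S → Set
    _≈A_ : A → A → Set
    o t : A → S

toSGraph : Graph → SGraph
toSGraph Γ = record { S = Graph.S Γ ; A = Graph.A Γ ; _≈S_ = _≡_ ; _≈A_ = _≡_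
                    ; o = Graph.o Γ ; t = Graph.t Γ }

module _ (Γ : SGraph) where
  open SGraph Γ

  IsSubgraph : (S → Set) → (A → Set) → Set
  IsSubgraph PS PA = ∀ a → PA a → PS (o a) × PS (t a)

  FiniteSub : (S → Set) → (A → Set) → Set
  FiniteSub PS PA =
    Σ (List S) (λ vs → ∀ v → PS v → Any (v ≈S_) vs) ×
    Σ (List A) (λ es → ∀ a → PA a → Any (a ≈A_) es)

  data Walk (PA : A → Set) (u : S) : S → Set where
    nil : ∀ {v} → u ≈S v → Walk PA u v
    fwd : (a : A) → PA a → u ≈S o a → ∀ {v} → Walk PA (t a) v → Walk PA u v
    bwd : (a : A) → PA a → u ≈S t a → ∀ {v} → Walk PA (o a) v → Walk PA u v

  next : ∀ {n} → Fin n → Fin n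
  next {suc n} k = fromℕ< (m%n<n (suc (toℕ k)) (suc n))

  Joins : A → S → S → Set
  Joins a x y = (o a ≈S x × t a ≈S y) ⊎ (t a ≈S x × o a ≈S y)

  -- a circuit of length n ≥ 1 (Serre): a subgraph isomorphic to Circ_n,
  -- i.e. pairwise distinct vertices v_0..v_{n-1} and pairwise distinct
  -- edges e_0..e_{n-1}, e_k joining v_k and v_{k+1 mod n}
  record Circuit (PS : S → Set) (PA : A → Set) : Set where
    field
      len     : ℕ
      v       : Fin (suc len) → S
      e       : Fin (suc len) → A
      v-in    : ∀ k → PS (v k)
      e-in    : ∀ k → PA (e k)
      v-inj   : ∀ k l → v k ≈S v l → k ≡ l
      e-inj   : ∀ k l → e k ≈A e l → k ≡ l
      joins   : ∀ k → Joins (e k) (v k) (v (next k))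

  IsTreeIn : (S → Set) → (A → Set) → Set
  IsTreeIn PS PA =
    Σ S PS ×
    (∀ u v → PS u → PS v → Walk PA u v) ×
    ¬ Circuit PS PA

  IsTree : Set
  IsTree = IsTreeIn (λ _ → ⊤) (λ _ → ⊤)

  IsFiniteTreeIn : (S → Set) → (A → Set) → Set
  IsFiniteTreeIn PS PA = IsSubgraph PS PA × FiniteSub PS PA × IsTreeIn PS PA

  -- (PS, PA) is a fundamental domain for an action (actS, actA) of a
  -- set of group elements Gr: a subgraph such that T → Gr\Γ is a graph
  -- isomorphism, i.e. every orbit (of vertices, resp. edges) meets T in
  -- exactly one element.
  IsFundamentalDomain : (Gr : Set) → (Gr → S → S) → (Gr → A → A) →
                        (S → Set) → (A → Set) → Set
  IsFundamentalDomain Gr actS actA PS PA =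
    IsSubgraph PS PA ×
    (∀ v → Σ Gr (λ g → Σ S (λ w → PS w × actS g w ≈S v))) ×
    (∀ w w' (g : Gr) → PS w → PS w' → actS g w ≈S w' → w ≈S w') ×
    (∀ a → Σ Gr (λ g → Σ A (λ b → PA b × actA g b ≈A a))) ×
    (∀ b b' (g : Gr) → PA b → PA b' → actA g b ≈A b' → b ≈A b')

record DfafSetting : Set₁ where
  field
    I      : Set
    _≤_    : I → I → Set
    ≤-refl : ∀ i → i ≤ i
    ≤-trans : ∀ {i j k} → i ≤ j → j ≤ k → i ≤ k
    directed : ∀ i j → Σ I (λ k → i ≤ k × j ≤ k)

    Γ : I → Graph
  module Γ (i : I) = Graph (Γ i)
  field
    θS : ∀ {i j} → i ≤ j → Γ.S j → Γ.S i
    θA : ∀ {i j} → i ≤ j → Γ.A j → Γ.A i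
    θ-o : ∀ {i j} (p : i ≤ j) a → Γ.o i (θA p a) ≡ θS p (Γ.o j a)
    θ-t : ∀ {i j} (p : i ≤ j) a → Γ.t i (θA p a) ≡ θS p (Γ.t j a)
    θS-surj : ∀ {i j} (p : i ≤ j) x → Σ (Γ.S j) (λ y → θS p y ≡ x)
    θA-surj : ∀ {i j} (p : i ≤ j) x → Σ (Γ.A j) (λ y → θA p y ≡ x)
    θS-id : ∀ {i} (p : i ≤ i) x → θS p x ≡ x
    θA-id : ∀ {i} (p : i ≤ i) x → θA p x ≡ x
    θS-comp : ∀ {i j k} (p : i ≤ j) (q : j ≤ k) (pq : i ≤ k) x →
              θS p (θS q x) ≡ θS pq x
    θA-comp : ∀ {i j k} (p : i ≤ j) (q : j ≤ k) (pq : i ≤ k) x →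
              θA p (θA q x) ≡ θA pq x

    sS : ∀ {i j} → i ≤ j → Γ.S i → Γ.S j
    sA : ∀ {i j} → i ≤ j → Γ.A i → Γ.A j
    θsS : ∀ {i j} (p : i ≤ j) x → θS p (sS p x) ≡ x
    θsA : ∀ {i j} (p : i ≤ j) x → θA p (sA p x) ≡ x
    sS-id : ∀ {i} (p : i ≤ i) x → sS p x ≡ x
    sA-id : ∀ {i} (p : i ≤ i) x → sA p x ≡ x
    sS-comp : ∀ {i j k} (p : i ≤ j) (q : j ≤ k) (pq : i ≤ k) x →
              sS q (sS p x) ≡ sS pq x
    sA-comp : ∀ {i j k} (p : i ≤ j) (q : j ≤ k) (pq : i ≤ k) x →
              sA q (sA p x) ≡ sA pq x
    C1 : ∀ i (a : Γ.A i) → Σ I (λ i₀ → Σ (i ≤ i₀) (λ p →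
           ∀ k (q : i₀ ≤ k) (pq : i ≤ k) →
             Γ.o k (sA pq a) ≡ sS q (Γ.o i₀ (sA p a)) ×
             Γ.t k (sA pq a) ≡ sS q (Γ.t i₀ (sA p a))))

  LimS : Set
  LimS = Σ I Γ.S
  LimA : Set
  LimA = Σ I Γ.A
  _≈LS_ : LimS → LimS → Set
  (i , x) ≈LS (j , y) = Σ I (λ k → Σ (i ≤ k) (λ p → Σ (j ≤ k) (λ q → sS p x ≡ sS q y)))
  _≈LA_ : LimA → LimA → Set
  (i , x) ≈LA (j , y) = Σ I (λ k → Σ (i ≤ k) (λ p → Σ (j ≤ k) (λ q → sA p x ≡ sA q y)))
  limO : LimA → LimS
  limO (i , a) = let (i₀ , p , _) = C1 i a in (i₀ , Γ.o i₀ (sA p a))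
  limT : LimA → LimS
  limT (i , a) = let (i₀ , p , _) = C1 i a in (i₀ , Γ.t i₀ (sA p a))

  LimΓ : SGraph
  LimΓ = record { S = LimS ; A = LimA ; _≈S_ = _≈LS_ ; _≈A_ = _≈LA_
                ; o = limO ; t = limT }

  field
    arborescent : IsTree LimΓ

    -- the profinite group G, given through its finite quotients
    -- G_i = G / U_i (π_i : G → G_i surjective homomorphism with kernel U_i)
    G  : Group 0ℓ 0ℓ
    Gq : I → Group 0ℓ 0ℓ
  module G = Group G
  module Gq (i : I) = Group (Gq i)
  field
    G-≡  : ∀ {x y} → x G.≈ y → x ≡ y
    Gq-≡ : ∀ i {x y} → Gq._≈_ i x y → x ≡ y
    Gq-finite : ∀ i → Σ (List (Gq.Carrier i)) (λ xs → ∀ x → Any (x ≡_) xs)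
    π : ∀ i → G.Carrier → Gq.Carrier i
    π-hom : ∀ i g h → π i (g G.∙ h) ≡ Gq._∙_ i (π i g) (π i h)
    π-surj : ∀ i x → Σ G.Carrier (λ g → π i g ≡ x)
  U : I → G.Carrier → Set
  U i g = π i g ≡ Gq.ε i
  field
    U-mono : ∀ i j → i ≤ j → ∀ g → U j g → U i g
    U-mono⁻ : ∀ i j → (∀ g → U j g → U i g) → i ≤ j
    U-sep : ∀ g → (∀ i → U i g) → g ≡ G.ε
    φ : ∀ {i j} → i ≤ j → Gq.Carrier j → Gq.Carrier i
    φπ : ∀ {i j} (p : i ≤ j) g → φ p (π j g) ≡ π i g
    complete : (h : ∀ i → Gq.Carrier i) →
               (∀ {i j} (p : i ≤ j) → φ p (h j) ≡ h i) →
               Σ G.Carrier (λ g → ∀ i → π i g ≡ h i)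

    r : ∀ {i j} → i ≤ j → Gq.Carrier i → Gq.Carrier j
    φr : ∀ {i j} (p : i ≤ j) g → φ p (r p g) ≡ g
    r-id : ∀ {i} (p : i ≤ i) g → r p g ≡ g
    r-comp : ∀ {i j k} (p : i ≤ j) (q : j ≤ k) (pq : i ≤ k) g →
             r q (r p g) ≡ r pq g

  LimG : Set
  LimG = Σ I Gq.Carrier
  ι : LimG → (j : I) → Gq.Carrier j
  ι (i , g) j = let (k , p , q) = directed i j in φ q (r p g)

  field
    -- r is a section: the image of ι is a subgroup
    ι-ε : Σ LimG (λ x → ∀ j → ι x j ≡ Gq.ε j)
    ι-∙ : ∀ x y → Σ LimG (λ z → ∀ j → ι z j ≡ Gq._∙_ j (ι x j) (ι y j))
    ι-⁻¹ : ∀ x → Σ LimG (λ z → ∀ j → ι z j ≡ Gq._⁻¹ j (ι x j))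

    actS : ∀ i → Gq.Carrier i → Γ.S i → Γ.S i
    actA : ∀ i → Gq.Carrier i → Γ.A i → Γ.A i
    actS-ε : ∀ i x → actS i (Gq.ε i) x ≡ x
    actA-ε : ∀ i x → actA i (Gq.ε i) x ≡ x
    actS-∙ : ∀ i g h x → actS i (Gq._∙_ i g h) x ≡ actS i g (actS i h x)
    actA-∙ : ∀ i g h x → actA i (Gq._∙_ i g h) x ≡ actA i g (actA i h x)
    act-o : ∀ i g a → Γ.o i (actA i g a) ≡ actS i g (Γ.o i a)
    act-t : ∀ i g a → Γ.t i (actA i g a) ≡ actS i g (Γ.t i a)
    θ-actS : ∀ {i j} (p : i ≤ j) g x → θS p (actS j g x) ≡ actS i (φ p g) (θS p x)
    θ-actA : ∀ {i j} (p : i ≤ j) g x → θA p (actA j g x) ≡ actA i (φ p g) (θA p x)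
    C3S : ∀ i g (a : Γ.S i) → Σ I (λ i₀ → Σ (i ≤ i₀) (λ p →
            ∀ k (q : i₀ ≤ k) (pq : i ≤ k) →
              sS q (actS i₀ (r p g) (sS p a)) ≡ actS k (r pq g) (sS pq a)))
    C3A : ∀ i g (a : Γ.A i) → Σ I (λ i₀ → Σ (i ≤ i₀) (λ p →
            ∀ k (q : i₀ ≤ k) (pq : i ≤ k) →
              sA q (actA i₀ (r p g) (sA p a)) ≡ actA k (r pq g) (sA pq a)))

    TS : ∀ i → Γ.S i → Set
    TA : ∀ i → Γ.A i → Set
    T-finiteTree : ∀ i → IsFiniteTreeIn (toSGraph (Γ i)) (TS i) (TA i)
    T-fundDom : ∀ i → IsFundamentalDomain (toSGraph (Γ i)) (Gq.Carrier i)
                        (actS i) (actA i) (TS i) (TA i)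
    sTS : ∀ {i j} (p : i ≤ j) x → TS j x → Σ (Γ.S i) (λ y → TS i y × sS p y ≡ x)
    sTS⁻ : ∀ {i j} (p : i ≤ j) y → TS i y → TS j (sS p y)
    sTA : ∀ {i j} (p : i ≤ j) x → TA j x → Σ (Γ.A i) (λ y → TA i y × sA p y ≡ x)
    sTA⁻ : ∀ {i j} (p : i ≤ j) y → TA i y → TA j (sA p y)
    sT-o : ∀ {i j} (p : i ≤ j) a → TA i a → Γ.o j (sA p a) ≡ sS p (Γ.o i a)
    sT-t : ∀ {i j} (p : i ≤ j) a → TA i a → Γ.t j (sA p a) ≡ sS p (Γ.t i a)
    C4S : ∀ i (α : Γ.S i) g → TS i α → Σ I (λ i₀ → i ≤ i₀ ×
            (∀ k → i₀ ≤ k → (pk : i ≤ k) →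
              sS pk (actS i g α) ≡ actS k (r pk g) (sS pk α)))
    C4A : ∀ i (α : Γ.A i) g → TA i α → Σ I (λ i₀ → i ≤ i₀ ×
            (∀ k → i₀ ≤ k → (pk : i ≤ k) →
              sA pk (actA i g α) ≡ actA k (r pk g) (sA pk α)))

  limActS : LimG → LimS → LimS
  limActS (i , g) (j , a) =
    let (k , p , q) = directed i j
        gk = r p g
        ak = sS q a
        (i₀ , p₀ , _) = C3S k gk ak
    in (i₀ , actS i₀ (r p₀ gk) (sS p₀ ak))
  limActA : LimG → LimA → LimA
  limActA (i , g) (j , a) =
    let (k , p , q) = directed i j
        gk = r p g
        ak = sA q a
        (i₀ , p₀ , _) = C3A k gk ak
    in (i₀ , actA i₀ (r p₀ gk) (sA p₀ ak))

  TbarS : I → LimS → Set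
  TbarS i x = Σ (Γ.S i) (λ y → TS i y × (i , y) ≈LS x)
  TbarA : I → LimA → Set
  TbarA i x = Σ (Γ.A i) (λ y → TA i y × (i , y) ≈LA x)

-- Two elements of lim_s Γ_i are equal when they agree at some stage, and then at every later
-- stage.  So every finite configuration in the limit (a vertex and an element of T̄, or two
-- elements of T̄ and a group element relating them) can be pushed to one stage n, where the
-- fundamental-domain property of T_n applies; (C3) and (C4) say that the induced action is
-- computed by the action of G_n at large stages.  T̄ is connected because s restricted to T_i
-- is a graph morphism, and it has no circuit because lim_s Γ_i is a tree.
module Submission where

open import Defs
open import Data.Product using (Σ; _×_; _,_; proj₁; proj₂)
open import Data.Unit using (⊤; tt)
open import Data.List using (List; map)
open import Data.List.Relation.Unary.Any as Any using (Any)
open import Data.List.Relation.Unary.Any.Properties using (map⁺)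
open import Relation.Binary.PropositionalEquality
  using (_≡_; refl; sym; trans; cong; cong₂; module ≡-Reasoning)
open import Relation.Nullary using (¬_)

module _ (Γ : SGraph) where
  open SGraph Γ

  Circuit-⊤ : ∀ {PS PA} → Circuit Γ PS PA → Circuit Γ (λ _ → ⊤) (λ _ → ⊤)
  Circuit-⊤ c = record
    { len = len ; v = v ; e = e ; v-in = λ _ → tt ; e-in = λ _ → tt
    ; v-inj = v-inj ; e-inj = e-inj ; joins = joins }
    where open Circuit c

  IsTree⇒¬Circuit : IsTree Γ → ∀ {PS PA} → ¬ Circuit Γ PS PA
  IsTree⇒¬Circuit (_ , _ , acyclic) c = acyclic (Circuit-⊤ c)

module InductiveLimit {I : Set} (_≤_ : I → I → Set)
  (≤-refl : ∀ i → i ≤ i)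
  (≤-trans : ∀ {i j k} → i ≤ j → j ≤ k → i ≤ k)
  (directed : ∀ i j → Σ I (λ k → i ≤ k × j ≤ k))
  (X : I → Set) (s : ∀ {i j} → i ≤ j → X i → X j)
  (s-comp : ∀ {i j k} (p : i ≤ j) (q : j ≤ k) (pq : i ≤ k) x → s q (s p x) ≡ s pq x)
  where

  upperBound₃ : ∀ a b c → Σ I λ n → a ≤ n × b ≤ n × c ≤ n
  upperBound₃ a b c =
    let (m , am , bm) = directed a b
        (n , mn , cn) = directed m c
    in n , ≤-trans am mn , ≤-trans bm mn , cn

  Lim : Set
  Lim = Σ I X

  _≈_ : Lim → Lim → Set
  (i , x) ≈ (j , y) = Σ I λ k → Σ (i ≤ k) λ p → Σ (j ≤ k) λ q → s p x ≡ s q y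

  s-agree-later : ∀ {i j k n} (p : i ≤ k) (q : j ≤ k) (kn : k ≤ n) (p' : i ≤ n) (q' : j ≤ n)
                  {x y} → s p x ≡ s q y → s p' x ≡ s q' y
  s-agree-later p q kn p' q' {x} {y} e = begin
    s p' x         ≡⟨ sym (s-comp p kn p' x) ⟩
    s kn (s p x)   ≡⟨ cong (s kn) e ⟩
    s kn (s q y)   ≡⟨ s-comp q kn q' y ⟩
    s q' y         ∎
    where open ≡-Reasoning

  ≈-refl : ∀ x → x ≈ x
  ≈-refl (i , x) = i , ≤-refl i , ≤-refl i , refl

  ≈-sym : ∀ {x y} → x ≈ y → y ≈ x
  ≈-sym (k , p , q , e) = k , q , p , sym e

  ≈-trans : ∀ {x y z} → x ≈ y → y ≈ z → x ≈ z
  ≈-trans (k , p , q , e) (k' , p' , q' , e') =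
    let (n , kn , k'n) = directed k k'
        jn = ≤-trans q kn
    in n , ≤-trans p kn , ≤-trans q' k'n ,
       trans (s-agree-later p q kn (≤-trans p kn) jn e)
             (s-agree-later p' q' k'n jn (≤-trans q' k'n) e')

  Image : (i : I) → (X i → Set) → Lim → Set
  Image i P x = Σ (X i) λ y → P y × (i , y) ≈ x

  Image-finite : ∀ i {P : X i → Set} (ys : List (X i)) → (∀ y → P y → Any (y ≡_) ys) →
                 ∀ x → Image i P x → Any (x ≈_) (map (i ,_) ys)
  Image-finite i ys enum x (y , py , y≈x) =
    map⁺ (Any.map (λ { refl → ≈-sym y≈x }) (enum y py))

  module Action (Gr : I → Set) (r : ∀ {i j} → i ≤ j → Gr i → Gr j)
    (r-comp : ∀ {i j k} (p : i ≤ j) (q : j ≤ k) (pq : i ≤ k) g → r q (r p g) ≡ r pq g)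
    (act : ∀ i → Gr i → X i → X i)
    (C3 : ∀ i g (a : X i) → Σ I (λ i₀ → Σ (i ≤ i₀) (λ p →
            ∀ k (q : i₀ ≤ k) (pq : i ≤ k) →
              s q (act i₀ (r p g) (s p a)) ≡ act k (r pq g) (s pq a))))
    where

    limAct : Σ I Gr → Lim → Lim
    limAct (i , g) (j , a) =
      let (k , p , q) = directed i j
          gk = r p g
          ak = s q a
          (i₀ , p₀ , _) = C3 k gk ak
      in (i₀ , act i₀ (r p₀ gk) (s p₀ ak))

    limAct-eventually : ∀ l h j w → let (i₀ , b) = limAct (l , h) (j , w) in
      l ≤ i₀ × j ≤ i₀ ×
      (∀ n (q : i₀ ≤ n) (ln : l ≤ n) (jn : j ≤ n) → s q b ≡ act n (r ln h) (s jn w))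
    limAct-eventually l h j w =
      ≤-trans p p₀ , ≤-trans q p₀ , λ n q' ln jn →
        trans (c3 n q' (≤-trans p₀ q'))
              (cong₂ (act n) (r-comp p (≤-trans p₀ q') ln h) (s-comp q (≤-trans p₀ q') jn w))
      where
        k = proj₁ (directed l j)
        p = proj₁ (proj₂ (directed l j))
        q = proj₂ (proj₂ (directed l j))
        p₀ = proj₁ (proj₂ (C3 k (r p h) (s q w)))
        c3 = proj₂ (proj₂ (C3 k (r p h) (s q w)))

    module FundamentalDomain (T : ∀ i → X i → Set)
      (T-pullback : ∀ {i j} (p : i ≤ j) x → T j x → Σ (X i) (λ y → T i y × s p y ≡ x))
      (T-push : ∀ {i j} (p : i ≤ j) y → T i y → T j (s p y))
      (T-cover : ∀ i x → Σ (Gr i) λ g → Σ (X i) λ w → T i w × act i g w ≡ x)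
      (T-rigid : ∀ i w w' g → T i w → T i w' → act i g w ≡ w' → w ≡ w')
      (C4 : ∀ i (α : X i) g → T i α → Σ I (λ i₀ → i ≤ i₀ ×
              (∀ k → i₀ ≤ k → (pk : i ≤ k) → s pk (act i g α) ≡ act k (r pk g) (s pk α))))
      where

      Tbar : I → Lim → Set
      Tbar i = Image i (T i)

      Tbar-mono : ∀ i j x → Tbar i x → Tbar j x
      Tbar-mono i j x (y , ty , y≈x) =
        let (k , ik , jk) = directed i j
            (z , tz , sz≡sy) = T-pullback jk (s ik y) (T-push ik y ty)
        in z , tz , ≈-trans (k , jk , ik , sz≡sy) y≈x

      limAct-cover : ∀ i v → Σ (Σ I Gr) λ g → Σ Lim λ w → Tbar i w × limAct g w ≈ v
      limAct-cover i (j , x) with T-cover j x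
      ... | g , w , tw , refl =
        let (i₁ , _ , c4) = C4 j w g tw
            (_ , ji₀ , eventually) = limAct-eventually j g j w
            i₀ = proj₁ (limAct (j , g) (j , w))
            (n , i₀n , i₁n) = directed i₀ i₁
            jn = ≤-trans ji₀ i₀n
        in (j , g) , (j , w) , Tbar-mono j i (j , w) (w , tw , ≈-refl (j , w)) ,
           (n , i₀n , jn , trans (eventually n i₀n jn jn) (sym (c4 n i₁n jn)))

      limAct-rigid : ∀ i w w' g → Tbar i w → Tbar i w' → limAct g w ≈ w' → w ≈ w'
      limAct-rigid i (j , w) (j' , w') (l , h)
                   (y , ty , (m₁ , p₁ , q₁ , e₁)) (y' , ty' , (m₂ , p₂ , q₂ , e₂))
                   (m₃ , p₃ , q₃ , e₃) =
        n , jn , j'n , trans (sym y~w) (trans sy≡sy' y'~w')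
        where
          open ≡-Reasoning
          i₀ = proj₁ (limAct (l , h) (j , w))
          ln = proj₁ (limAct-eventually l h j w)
          eventually = proj₂ (proj₂ (limAct-eventually l h j w))
          bound = upperBound₃ m₁ m₂ m₃
          n = proj₁ bound
          m₁n = proj₁ (proj₂ bound)
          m₂n = proj₁ (proj₂ (proj₂ bound))
          m₃n = proj₂ (proj₂ (proj₂ bound))
          i₀n = ≤-trans p₃ m₃n
          in' = ≤-trans p₁ m₁n
          jn = ≤-trans q₁ m₁n
          j'n = ≤-trans q₃ m₃n
          hn = r (≤-trans ln i₀n) h
          y~w : s in' y ≡ s jn w
          y~w = s-agree-later p₁ q₁ m₁n in' jn e₁
          y'~w' : s in' y' ≡ s j'n w'
          y'~w' = s-agree-later p₂ q₂ m₂n in' j'n e₂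
          hy≡y' : act n hn (s in' y) ≡ s in' y'
          hy≡y' = begin
            act n hn (s in' y)                              ≡⟨ cong (act n hn) y~w ⟩
            act n hn (s jn w)                               ≡⟨ sym (eventually n i₀n (≤-trans ln i₀n) jn) ⟩
            s i₀n (proj₂ (limAct (l , h) (j , w)))          ≡⟨ s-agree-later p₃ q₃ m₃n i₀n j'n e₃ ⟩
            s j'n w'                                        ≡⟨ sym y'~w' ⟩
            s in' y'                                        ∎
          sy≡sy' : s in' y ≡ s in' y'
          sy≡sy' = T-rigid n (s in' y) (s in' y') hn (T-push in' y ty) (T-push in' y' ty') hy≡y'

module _ (D : DfafSetting) where
  open DfafSetting D

  module V = InductiveLimit _≤_ ≤-refl ≤-trans directed Γ.S sS sS-comp
  module E = InductiveLimit _≤_ ≤-refl ≤-trans directed Γ.A sA sA-comp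

  module VT = V.Action.FundamentalDomain Gq.Carrier r r-comp actS C3S TS sTS sTS⁻
    (λ i → proj₁ (proj₂ (T-fundDom i)))
    (λ i → proj₁ (proj₂ (proj₂ (T-fundDom i))))
    C4S
  module ET = E.Action.FundamentalDomain Gq.Carrier r r-comp actA C3A TA sTA sTA⁻
    (λ i → proj₁ (proj₂ (proj₂ (proj₂ (T-fundDom i)))))
    (λ i → proj₂ (proj₂ (proj₂ (proj₂ (T-fundDom i)))))
    C4A

  module Endpoint (end : ∀ i → Γ.A i → Γ.S i)
    (C1-end : ∀ j a k (q : proj₁ (C1 j a) ≤ k) (jk : j ≤ k) →
              end k (sA jk a) ≡ sS q (end _ (sA (proj₁ (proj₂ (C1 j a))) a)))
    (sT-end : ∀ {i j} (p : i ≤ j) a → TA i a → end j (sA p a) ≡ sS p (end i a))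
    where

    limEnd : LimA → LimS
    limEnd (j , a) = proj₁ (C1 j a) , end _ (sA (proj₁ (proj₂ (C1 j a))) a)

    limEnd-T : ∀ i y → TA i y → ∀ a → a E.≈ (i , y) → limEnd a V.≈ (i , end i y)
    limEnd-T i y ty (j , a) (m , jm , im , e) =
      let i₀ = proj₁ (C1 j a)
          (n , i₀n , mn) = directed i₀ m
          jn = ≤-trans jm mn
          in' = ≤-trans im mn
      in n , i₀n , in' ,
         trans (sym (C1-end j a n i₀n jn))
               (trans (cong (end n) (E.s-agree-later jm im mn jn in' e)) (sT-end in' y ty))

  open Endpoint Γ.o (λ j a k q jk → proj₁ (proj₂ (proj₂ (C1 j a)) k q jk)) sT-o
    renaming (limEnd-T to limO-T)
  open Endpoint Γ.t (λ j a k q jk → proj₂ (proj₂ (proj₂ (C1 j a)) k q jk)) sT-t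
    renaming (limEnd-T to limT-T)

  Tbar-subgraph : ∀ i → IsSubgraph LimΓ (TbarS i) (TbarA i)
  Tbar-subgraph i a (y , ty , y≈a) =
    let (to , tt′) = proj₁ (T-finiteTree i) y ty
    in (Γ.o i y , to , V.≈-sym (limO-T i y ty a (E.≈-sym y≈a))) ,
       (Γ.t i y , tt′ , V.≈-sym (limT-T i y ty a (E.≈-sym y≈a)))

  Tbar-finite : ∀ i → FiniteSub LimΓ (TbarS i) (TbarA i)
  Tbar-finite i =
    let ((vs , enumV) , (es , enumE)) = proj₁ (proj₂ (T-finiteTree i))
    in (map (i ,_) vs , V.Image-finite i vs enumV) ,
       (map (i ,_) es , E.Image-finite i es enumE)

  Walk-push : ∀ i {y y'} → Walk (toSGraph (Γ i)) (TA i) y y' → ∀ x x' →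
              x V.≈ (i , y) → (i , y') V.≈ x' → Walk LimΓ (TbarA i) x x'
  Walk-push i (nil refl) x x' x≈y y'≈x' = nil (V.≈-trans x≈y y'≈x')
  Walk-push i (fwd a ta refl w) x x' x≈y y'≈x' =
    fwd (i , a) (a , ta , E.≈-refl (i , a))
        (V.≈-trans x≈y (V.≈-sym (limO-T i a ta (i , a) (E.≈-refl (i , a)))))
        (Walk-push i w _ x' (limT-T i a ta (i , a) (E.≈-refl (i , a))) y'≈x')
  Walk-push i (bwd a ta refl w) x x' x≈y y'≈x' =
    bwd (i , a) (a , ta , E.≈-refl (i , a))
        (V.≈-trans x≈y (V.≈-sym (limT-T i a ta (i , a) (E.≈-refl (i , a)))))
        (Walk-push i w _ x' (limO-T i a ta (i , a) (E.≈-refl (i , a))) y'≈x')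

  Tbar-tree : ∀ i → IsTreeIn LimΓ (TbarS i) (TbarA i)
  Tbar-tree i =
    let ((y₀ , ty₀) , connected , _) = proj₂ (proj₂ (T-finiteTree i))
    in ((i , y₀) , (y₀ , ty₀ , V.≈-refl (i , y₀))) ,
       (λ { u v (y , ty , y≈u) (y' , ty' , y'≈v) →
            Walk-push i (connected y y' ty ty') u v (V.≈-sym y≈u) y'≈v }) ,
       IsTree⇒¬Circuit LimΓ arborescent

mainTheorem4 : (X : DfafSetting) → let open DfafSetting X in
    (∀ i j → (∀ x → TbarS i x → TbarS j x) × (∀ x → TbarA i x → TbarA j x)) ×
    (∀ i → IsFiniteTreeIn LimΓ (TbarS i) (TbarA i) ×
    IsFundamentalDomain LimΓ LimG limActS limActA (TbarS i) (TbarA i))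
mainTheorem4 X =
  (λ i j → VT.Tbar-mono X i j , ET.Tbar-mono X i j) ,
  λ i → (Tbar-subgraph X i , Tbar-finite X i , Tbar-tree X i) ,
        (Tbar-subgraph X i , VT.limAct-cover X i , VT.limAct-rigid X i ,
                             ET.limAct-cover X i , ET.limAct-rigid X i)
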